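{- Let $A$ be an infinite set of integers that is bounded below and that does not contain all sufficiently large integers. Then there exists an asymptotically strictly decreasing sequence $(A_q)_{q=1}^{\infty}$ of sets of integers such that $A = \bigcap_{q=1}^{\infty} A_q$ and \[ hA = \bigcap_{q=1}^{\infty} hA_q \] for all positive integers $h$.
   Context: For a set $A$ of integers and a positive integer $h$, $hA = \{a_1+\cdots+a_h : a_i \in A \text{ for all } i\}$ is the $h$-fold sumset. A sequence of sets $(A_q)_{q=1}^{\infty}$ is decreasing if $A_q \supseteq A_{q+1}$ for all $q$, and asymptotically strictly decreasing if it is decreasing and $A_q \neq A_{q+1}$ for infinitely many $q$. -}

module Defs where

open import Level using (0ℓ)
open import Data.Nat using (ℕ; suc) renaming (_≤_ to _≤ℕ_)
open import Data.Integer using (ℤ; _≤_; +_)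
open import Data.Vec using (Vec)
open import Data.Vec.Relation.Unary.All using (All)
open import Data.List using (List)
open import Data.List.Membership.Propositional using (_∈_)
open import Data.Product using (Σ; ∃; _×_)
open import Relation.Nullary using (¬_)
open import Relation.Unary using (Pred; _⊆_)
open import Function.Bundles using (_⇔_)
open import Relation.Binary.PropositionalEquality using (_≡_)
import Data.Integer

IntSet : Set₁
IntSet = Pred ℤ 0ℓ

_≐_ : IntSet → IntSet → Set
X ≐ Y = ∀ x → X x ⇔ Y x

vsum : ∀ {n} → Vec ℤ n → ℤ
vsum = Data.Vec.foldr _ Data.Integer._+_ (+ 0)

sumset : ℕ → IntSet → IntSet
sumset h A x = Σ (Vec ℤ h) λ v → All A v × vsum v ≡ x

-- Intersection of a sequence of sets (indexed by q : ℕ; index q stands for q+1).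
⋂ : (ℕ → IntSet) → IntSet
⋂ Aq x = ∀ q → Aq q x

Infinite : IntSet → Set
Infinite A = (l : List ℤ) → ∃ λ a → A a × ¬ (a ∈ l)

BoundedBelow : IntSet → Set
BoundedBelow A = ∃ λ m → ∀ a → A a → m ≤ a

ContainsAllLarge : IntSet → Set
ContainsAllLarge A = ∃ λ N → ∀ n → N ≤ n → A n

Decreasing : (ℕ → IntSet) → Set
Decreasing Aq = ∀ q → Aq (suc q) ⊆ Aq q

AsympStrictlyDecreasing : (ℕ → IntSet) → Set
AsympStrictlyDecreasing Aq =
  Decreasing Aq × (∀ Q → ∃ λ q → Q ≤ℕ q × ¬ (Aq q ≐ Aq (suc q)))

{-# OPTIONS --safe #-}
-- Classically one takes A_q = A ∪ {c_j : j ≥ q}, where c_0 < c_1 < ⋯ enumerate the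
-- non-members of A above a lower bound m of A: an h-fold sum using some c_j with j ≥ q is
-- at least h·m + q, so for large q every representation of a fixed x in hA_q lies in hA.
--
-- Constructively the complement of A cannot be enumerated. GapChain m q, the non-members
-- having q smaller non-members above m, stands in for {c_j : j ≥ q}, and A_q also contains
-- the point m − (k+1) for every k ≥ q with Marker k: decidability of the finitely many
-- statements y ∈ hA with h, |y| ≤ k, together with the absence of gap chains of length k.
-- Classically no marker exists, but none can be refuted outright. If A_q = A_{q+1}, every
-- gap chain of length q extends, so there are none, hence ¬¬ Marker q, yet the marker
-- point lies in A_q ∖ A_{q+1}. If x ∈ hA_q for all q, a marker in a representation of x
-- decides x ∈ hA; were x ∉ hA, markers would occur at every level, making A decidable, and
-- then A omitting arbitrarily large integers yields gap chains of every length,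
-- contradicting the marker.

module Submission where

open import Defs
open import Data.Nat using (ℕ; suc; _≤_)
open import Data.Product using (Σ; _×_)
open import Relation.Nullary using (¬_)

open import Level using (Level)
open import Data.Nat as ℕ using (zero; z≤n; s≤s; _<_)
import Data.Nat.Properties as ℕP
open import Data.Integer as ℤ using (ℤ; +_; -[1+_]; ∣_∣; _+_; _-_; _*_)
import Data.Integer.Properties as ℤP
open import Data.Integer.Tactic.RingSolver using (solve-∀)
open import Data.Vec using (Vec; []; _∷_)
open import Data.Vec.Relation.Unary.All as All using (All; []; _∷_)
open import Data.Vec.Relation.Unary.Any as Any using (Any; here; there)
open import Data.Product using (∃; _,_; proj₁; proj₂; map₂)
open import Data.Sum as Sum using (_⊎_; inj₁; inj₂; [_,_]′)
open import Function using (id)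
open import Function.Bundles using (_⇔_; mk⇔; Equivalence)
open import Relation.Nullary using (Dec)
open import Relation.Nullary.Negation using (¬¬-map; contradiction)
open import Relation.Nullary.Decidable as Dec using (¬¬-excluded-middle; decidable-stable)
open import Relation.Unary using (Pred; _⊆_; _∪_)
open import Relation.Binary.PropositionalEquality using (_≡_; refl; sym; trans; cong; subst)

¬¬-∀≤ : {P : ℕ → Set} → (∀ i → ¬ ¬ P i) → ∀ k → ¬ ¬ (∀ i → i ≤ k → P i)
¬¬-∀≤ ¬¬P zero    ¬all = ¬¬P 0 λ p₀ → ¬all λ { zero _ → p₀ ; (suc _) () }
¬¬-∀≤ ¬¬P (suc k) ¬all = ¬¬P 0 λ p₀ → ¬¬-∀≤ (λ i → ¬¬P (suc i)) k λ ps →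
  ¬all λ { zero _ → p₀ ; (suc i) (s≤s i≤k) → ps i i≤k }

¬¬-∀∣∣≤ : {P : ℤ → Set} → (∀ y → ¬ ¬ P y) → ∀ k → ¬ ¬ (∀ y → ∣ y ∣ ≤ k → P y)
¬¬-∀∣∣≤ {P} ¬¬P k = ¬¬-map fromPairs (¬¬-∀≤ ¬¬pair k)
  where
  ¬¬pair : ∀ i → ¬ ¬ (P (+ i) × P -[1+ i ])
  ¬¬pair i ¬both = ¬¬P (+ i) λ p → ¬¬P -[1+ i ] λ p′ → ¬both (p , p′)
  fromPairs : (∀ i → i ≤ k → P (+ i) × P -[1+ i ]) → ∀ y → ∣ y ∣ ≤ k → P y
  fromPairs pairs (+ i)    i≤k   = proj₁ (pairs i i≤k)
  fromPairs pairs -[1+ i ] 1+i≤k = proj₂ (pairs i (ℕP.<⇒≤ 1+i≤k))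

All-∪⁻ : ∀ {a p q : Level} {X : Set a} {P : Pred X p} {Q : Pred X q} {n} {xs : Vec X n} →
         All (P ∪ Q) xs → All P xs ⊎ Any Q xs
All-∪⁻ []              = inj₁ []
All-∪⁻ (inj₁ px ∷ pqs) = Sum.map (px ∷_) there (All-∪⁻ pqs)
All-∪⁻ (inj₂ qx ∷ _)   = inj₂ (here qx)

vsum-≥ : ∀ {N n} {xs : Vec ℤ n} → All (N ℤ.≤_) xs → + n * N ℤ.≤ vsum xs
vsum-≥ []                          = ℤP.≤-refl
vsum-≥ {N} {suc n} (N≤x ∷ N≤xs) =
  subst (ℤ._≤ _) (sym (ℤP.suc-* (+ n) N)) (ℤP.+-mono-≤ N≤x (vsum-≥ N≤xs))

vsum-≥-Any : ∀ {N q n} {xs : Vec ℤ n} → All (N ℤ.≤_) xs → Any (N + + q ℤ.≤_) xs →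
             + n * N + + q ℤ.≤ vsum xs
vsum-≥-Any {N} {q} {suc n} {x ∷ xs} (_ ∷ N≤xs) (here N+q≤x) = begin
  + suc n * N + + q   ≡⟨ cong (_+ + q) (ℤP.suc-* (+ n) N) ⟩
  N + + n * N + + q   ≡⟨ swap N (+ n * N) (+ q) ⟩
  N + + q + + n * N   ≤⟨ ℤP.+-mono-≤ N+q≤x (vsum-≥ N≤xs) ⟩
  x + vsum xs         ∎
  where
  open ℤP.≤-Reasoning
  swap : ∀ a b c → a + b + c ≡ a + c + b
  swap = solve-∀
vsum-≥-Any {N} {q} {suc n} {x ∷ xs} (N≤x ∷ N≤xs) (there hit) = begin
  + suc n * N + + q   ≡⟨ cong (_+ + q) (ℤP.suc-* (+ n) N) ⟩
  N + + n * N + + q   ≡⟨ ℤP.+-assoc N (+ n * N) (+ q) ⟩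
  N + (+ n * N + + q) ≤⟨ ℤP.+-mono-≤ N≤x (vsum-≥-Any N≤xs hit) ⟩
  x + vsum xs         ∎
  where open ℤP.≤-Reasoning

far-offset-≰ : ∀ N q {x} → ∣ N - x ∣ < q → ¬ (N + + q ℤ.≤ x)
far-offset-≰ N q {x} d<q N+q≤x = ℕP.<⇒≱ d<q (ℤP.drop‿+≤+ q≤x-N)
  where
  open ℤP.≤-Reasoning
  cancel : ∀ a b → (a + b) - a ≡ b
  cancel = solve-∀
  q≤x-N : + q ℤ.≤ + ∣ N - x ∣
  q≤x-N = begin
    + q           ≡⟨ sym (cancel N (+ q)) ⟩
    (N + + q) - N ≤⟨ ℤP.+-monoˡ-≤ (ℤ.- N) N+q≤x ⟩
    x - N         ≡⟨ sym (ℤP.∣-∣-≤ (ℤP.≤-trans (ℤP.i≤i+j N (+ q)) N+q≤x)) ⟩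
    + ∣ N - x ∣   ∎

sumset-1 : ∀ X x → sumset 1 X x ⇔ X x
sumset-1 X x = mk⇔
  (λ { (y ∷ [] , Xy ∷ [] , y+0≡x) → subst X (trans (sym (ℤP.+-identityʳ y)) y+0≡x) Xy })
  (λ Xx → x ∷ [] , Xx ∷ [] , ℤP.+-identityʳ x)

sumset-mono : ∀ {X Y} h → X ⊆ Y → sumset h X ⊆ sumset h Y
sumset-mono h X⊆Y (v , Xv , Σv≡x) = v , All.map X⊆Y Xv , Σv≡x

module GapChains (A : IntSet) where

  GapChain : ℤ → ℕ → IntSet
  GapChain N zero    x = N ℤ.≤ x × ¬ A x
  GapChain N (suc j) x = ¬ A x × ∃ λ y → y ℤ.< x × GapChain N j y

  gap-∉ : ∀ {N} j {x} → GapChain N j x → ¬ A x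
  gap-∉ zero    (_ , ∉A) = ∉A
  gap-∉ (suc j) (∉A , _) = ∉A

  gap-≥ : ∀ {N} j {x} → GapChain N j x → N + + j ℤ.≤ x
  gap-≥ {N} zero    {x} (N≤x , _) = subst (ℤ._≤ x) (sym (ℤP.+-identityʳ N)) N≤x
  gap-≥ {N} (suc j) {x} (_ , y , y<x , c) =
    subst (ℤ._≤ x) (shift N (+ j)) (ℤP.i<j⇒suc[i]≤j (ℤP.≤-<-trans (gap-≥ j c) y<x))
    where
    shift : ∀ a b → + 1 + (a + b) ≡ a + (+ 1 + b)
    shift = solve-∀

  gap-≥-base : ∀ {N} j {x} → GapChain N j x → N ℤ.≤ x
  gap-≥-base {N} j c = ℤP.≤-trans (ℤP.i≤i+j N (+ j)) (gap-≥ j c)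

  gap-pred : ∀ {N} j → GapChain N (suc j) ⊆ GapChain N j
  gap-pred zero    (∉A , y , y<x , N≤y , _) = ℤP.≤-trans N≤y (ℤP.<⇒≤ y<x) , ∉A
  gap-pred (suc j) (∉A , y , y<x , c)       = ∉A , y , y<x , gap-pred j c

  extendable⇒no-chain : ∀ {N q} → GapChain N q ⊆ GapChain N (suc q) → ¬ ∃ (GapChain N q)
  extendable⇒no-chain {N} {q} extend (x , c) =
    far-offset-≰ N (suc d ℕ.+ q) (ℕP.m≤m+n (suc d) q) (gap-≥ (suc d ℕ.+ q) (lengthen (suc d) c))
    where
    d = ∣ N - x ∣
    step : ∀ i → GapChain N (i ℕ.+ q) ⊆ GapChain N (suc i ℕ.+ q)
    step zero    c                  = extend c
    step (suc i) (∉A , y , y<x , c) = ∉A , y , y<x , step i c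
    lengthen : ∀ i → GapChain N q ⊆ GapChain N (i ℕ.+ q)
    lengthen zero    c = c
    lengthen (suc i) c = step i (lengthen i c)

  prepend : ∀ {N x} → N ℤ.≤ x → ¬ A x → ∀ j → GapChain (ℤ.suc x) j ⊆ GapChain N (suc j)
  prepend N≤x ∉A zero    (1+x≤y , ∉A′)       = ∉A′ , _ , ℤP.suc[i]≤j⇒i<j 1+x≤y , N≤x , ∉A
  prepend N≤x ∉A (suc j) (∉A′ , z , z<y , c) = ∉A′ , z , z<y , prepend N≤x ∉A j c

  module _ (A? : ∀ x → Dec (A x)) (¬large : ¬ ContainsAllLarge A) where

    ¬¬-nonmember-above : ∀ N → ¬ ¬ ∃ λ x → N ℤ.≤ x × ¬ A x
    ¬¬-nonmember-above N none =
      ¬large (N , λ x N≤x → decidable-stable (A? x) λ ∉A → none (x , N≤x , ∉A))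

    ¬¬-gapChain : ∀ j N → ¬ ¬ ∃ (GapChain N j)
    ¬¬-gapChain zero    N none = ¬¬-nonmember-above N none
    ¬¬-gapChain (suc j) N none = ¬¬-nonmember-above N λ (x , N≤x , ∉A) →
      ¬¬-gapChain j (ℤ.suc x) λ (y , c) → none (y , prepend N≤x ∉A j c)

module Construction (A : IntSet) {m : ℤ} (m≤A : ∀ a → A a → m ℤ.≤ a) where
  open GapChains A

  DecidableUpTo : ℕ → Set
  DecidableUpTo k = ∀ h → h ≤ k → ∀ y → ∣ y ∣ ≤ k → Dec (sumset h A y)

  ¬¬-decidableUpTo : ∀ k → ¬ ¬ DecidableUpTo k
  ¬¬-decidableUpTo k = ¬¬-∀≤ (λ h → ¬¬-∀∣∣≤ (λ _ → ¬¬-excluded-middle) k) k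

  Marker : ℕ → Set
  Marker k = DecidableUpTo k × ¬ ∃ (GapChain m k)

  Markers : ℕ → IntSet
  Markers q x = ∃ λ k → q ≤ k × x ≡ m + -[1+ k ] × Marker k

  Aq : ℕ → IntSet
  Aq q = (A ∪ GapChain m q) ∪ Markers q

  A⊆Aq : ∀ {q} → A ⊆ Aq q
  A⊆Aq Ax = inj₁ (inj₁ Ax)

  unmarked-≥ : ∀ {q} → A ∪ GapChain m q ⊆ (m ℤ.≤_)
  unmarked-≥     (inj₁ Ax) = m≤A _ Ax
  unmarked-≥ {q} (inj₂ c)  = gap-≥-base q c

  marker-< : ∀ k → m + -[1+ k ] ℤ.< m
  marker-< k = subst (m + -[1+ k ] ℤ.<_) (ℤP.+-identityʳ m) (ℤP.+-monoʳ-< m ℤ.-<+)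

  marked-< : ∀ {q} → Markers q ⊆ (ℤ._< m)
  marked-< (k , _ , refl , _) = marker-< k

  markers-anti : ∀ {q q′} → q ≤ q′ → Markers q′ ⊆ Markers q
  markers-anti q≤q′ (k , q′≤k , x≡ , marker) = k , ℕP.≤-trans q≤q′ q′≤k , x≡ , marker

  Aq-decreasing : Decreasing Aq
  Aq-decreasing q (inj₁ (inj₁ Ax)) = A⊆Aq Ax
  Aq-decreasing q (inj₁ (inj₂ c))  = inj₁ (inj₂ (gap-pred q c))
  Aq-decreasing q (inj₂ marked)    = inj₂ (markers-anti (ℕP.n≤1+n q) marked)

  Aq-strict : ∀ q → ¬ (Aq q ≐ Aq (suc q))
  Aq-strict q Aq≐ = ¬¬-decidableUpTo q λ dec → marker-unremovable (dec , extendable⇒no-chain gap-extends)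
    where
    shrink : Aq q ⊆ Aq (suc q)
    shrink {x} = Equivalence.to (Aq≐ x)
    gap-extends : GapChain m q ⊆ GapChain m (suc q)
    gap-extends c with shrink (inj₁ (inj₂ c))
    ... | inj₁ (inj₁ Ax) = contradiction Ax (gap-∉ q c)
    ... | inj₁ (inj₂ c′) = c′
    ... | inj₂ marked    = contradiction (gap-≥-base q c) (ℤP.<⇒≱ (marked-< marked))
    marker-unremovable : ¬ Marker q
    marker-unremovable marker with shrink (inj₂ (q , ℕP.≤-refl , refl , marker))
    ... | inj₁ unmarked = ℤP.<⇒≱ (marker-< q) (unmarked-≥ {suc q} unmarked)
    ... | inj₂ (k , q<k , eq , _) = ℤP.<-irrefl (sym eq) (ℤP.+-monoʳ-< m (ℤ.-<- q<k))

  classify : ∀ {q n} {xs : Vec ℤ n} → All (Aq q) xs →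
             Any (Markers q) xs ⊎ All A xs ⊎ + n * m + + q ℤ.≤ vsum xs
  classify {q} xs∈ with All-∪⁻ xs∈
  ... | inj₂ marked   = inj₁ marked
  ... | inj₁ unmarked with All-∪⁻ unmarked
  ...   | inj₁ allA = inj₂ (inj₁ allA)
  ...   | inj₂ gap  = inj₂ (inj₂ (vsum-≥-Any (All.map unmarked-≥ unmarked) (Any.map (gap-≥ q) gap)))

  sumset-Aq⇒sumset-A⊎marker : ∀ h q {x} → ∣ + h * m - x ∣ < q →
                              sumset h (Aq q) x → sumset h A x ⊎ ∃ (Markers q)
  sumset-Aq⇒sumset-A⊎marker h q d<q (v , v∈ , Σv≡x) with classify v∈
  ... | inj₁ marked        = inj₂ (Any.satisfied marked)
  ... | inj₂ (inj₁ allA)   = inj₁ (v , allA , Σv≡x)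
  ... | inj₂ (inj₂ Σv-big) = contradiction (subst (_ ℤ.≤_) Σv≡x Σv-big) (far-offset-≰ (+ h * m) q d<q)

  markers-unbounded⇒decidable : (∀ q → ∃ (Markers q)) → ∀ y → Dec (A y)
  markers-unbounded⇒decidable markers y with markers (suc ∣ y ∣)
  ... | _ , k , ∣y∣<k , _ , decUpTo , _ =
    Dec.map (sumset-1 A y) (decUpTo 1 (ℕP.≤-trans (s≤s z≤n) ∣y∣<k) y (ℕP.<⇒≤ ∣y∣<k))

  module _ (¬large : ¬ ContainsAllLarge A) where

    markers-bounded : ¬ (∀ q → ∃ (Markers q))
    markers-bounded markers with markers 0
    ... | _ , k , _ , _ , _ , no-chain =
      ¬¬-gapChain (markers-unbounded⇒decidable markers) ¬large k m no-chain

    ⋂-sumset⊆sumset : ∀ h → ⋂ (λ q → sumset h (Aq q)) ⊆ sumset h A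
    ⋂-sumset⊆sumset h {x} x∈ = [ id , decide-by-marker ]′ (sumset-Aq⇒sumset-A⊎marker h q₀ d<q₀ (x∈ q₀))
      where
      d = ∣ + h * m - x ∣
      q₀ = h ℕ.+ ∣ x ∣ ℕ.+ suc d
      d<q₀ : d < q₀
      d<q₀ = ℕP.m≤n+m (suc d) (h ℕ.+ ∣ x ∣)
      markers-unbounded : ¬ sumset h A x → ∀ q → ∃ (Markers q)
      markers-unbounded x∉hA q =
        [ (λ x∈hA → contradiction x∈hA x∉hA) , map₂ (markers-anti (ℕP.m≤m+n q q₀)) ]′
          (sumset-Aq⇒sumset-A⊎marker h (q ℕ.+ q₀) (ℕP.≤-trans d<q₀ (ℕP.m≤n+m q₀ q)) (x∈ (q ℕ.+ q₀)))
      decide-by-marker : ∃ (Markers q₀) → sumset h A x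
      decide-by-marker (_ , k , q₀≤k , _ , decUpTo , _) =
        decidable-stable (decUpTo h (ℕP.m+n≤o⇒m≤o h h+∣x∣≤k) x (ℕP.m+n≤o⇒n≤o h h+∣x∣≤k))
          λ x∉hA → markers-bounded (markers-unbounded x∉hA)
        where
        h+∣x∣≤k : h ℕ.+ ∣ x ∣ ≤ k
        h+∣x∣≤k = ℕP.m+n≤o⇒m≤o (h ℕ.+ ∣ x ∣) q₀≤k

    A≐⋂Aq : A ≐ ⋂ Aq
    A≐⋂Aq x = mk⇔ (λ Ax _ → A⊆Aq Ax) λ x∈ →
      Equivalence.to (sumset-1 A x) (⋂-sumset⊆sumset 1 λ q → Equivalence.from (sumset-1 (Aq q) x) (x∈ q))

    sumset≐⋂sumset : ∀ h → sumset h A ≐ ⋂ (λ q → sumset h (Aq q))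
    sumset≐⋂sumset h x = mk⇔ (λ x∈hA _ → sumset-mono h A⊆Aq x∈hA) (⋂-sumset⊆sumset h)

mainTheorem4 : (A : IntSet) → Infinite A → BoundedBelow A → ¬ ContainsAllLarge A →
    Σ (ℕ → IntSet) λ Aq →
      AsympStrictlyDecreasing Aq × (A ≐ ⋂ Aq) ×
      ((h : ℕ) → 1 ≤ h → sumset h A ≐ ⋂ (λ q → sumset h (Aq q)))
mainTheorem4 A _ (m , m≤A) ¬large =
  Aq , (Aq-decreasing , λ Q → Q , ℕP.≤-refl , Aq-strict Q) ,
  A≐⋂Aq ¬large , λ h _ → sumset≐⋂sumset ¬large h
  where open Construction A m≤A
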